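{- (i) $\mathcal{C}$ is a proper subset of $\mathcal{S}'$. (ii) $\mathcal{C}'$ is a proper subset of $\mathcal{S}\cap\mathcal{C}$. (iii) $\mathcal{C}'_3=\mathcal{S}\cap\mathcal{C}_3$.
   Context: For an integer base $g\ge 2$ and integer $m\ge 0$, $s_g(m)$ denotes the sum of the base-$g$ digits of $m$; $s_1(m):=0$. A positive integer $m$ has an $s$-decomposition if $m=\prod_{\nu=1}^n g_\nu^{e_\nu}$ with exponents $e_\nu\ge1$ and proper factors $1<g_\nu<m$, strictly increasing $g_1<\dots<g_n$ (not necessarily coprime), such that $s_{g_\nu}(m)\ge g_\nu$ for each $\nu$; it is strict if $s_{g_\nu}(m)=g_\nu$ for each $\nu$. $\mathcal{S}'$ (resp. $\mathcal{S}$) is the set of positive integers having an $s$-decomposition (resp. strict $s$-decomposition). $\mathcal{C}$ is the set of Carmichael numbers (composite positive integers $m$ with $a^{m-1}\equiv1\pmod m$ for all integers $a$ coprime to $m$), and $\mathcal{C}_n$ the subset of those with exactly $n$ prime factors. $\mathcal{C}'$ is the set of squarefree integers $m>1$ with $s_p(m)=p$ for every prime $p\mid m$, and $\mathcal{C}'_n$ the subset of those with exactly $n$ prime factors. -}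

module Defs where

open import Data.Nat using (ℕ; zero; suc; _+_; _*_; _∸_; _^_; _≤_; _<_; _≥_)
open import Data.Nat.DivMod using (_/_; _%_)
open import Data.Nat.Divisibility using (_∣_)
open import Data.Nat.Primality using (Prime; Composite)
open import Data.Nat.Coprimality using (Coprime)
open import Data.Integer as ℤ using (ℤ; +_)
import Data.Integer.Divisibility as ℤD
open import Data.List using (List; []; _∷_; map; length)
open import Data.Nat.ListAction using (product)
open import Data.List.Relation.Unary.All using (All)
open import Data.List.Relation.Unary.Linked using (Linked)
open import Data.List.Relation.Unary.Unique.Propositional using (Unique)
open import Data.List.Membership.Propositional using (_∈_)
open import Data.Product using (Σ; _×_; proj₁; _,_)
open import Relation.Binary.PropositionalEquality using (_≡_)
open import Relation.Nullary using (¬_)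

-- Sum of base-(k+2) digits of m, computed with fuel (fuel m suffices since
-- each step strictly decreases m when m > 0).
digitSumAux : ℕ → ℕ → ℕ → ℕ
digitSumAux zero    b m = 0
digitSumAux (suc f) b zero = 0
digitSumAux (suc f) b (suc m) =
  (suc m % suc (suc b)) + digitSumAux f b (suc m / suc (suc b))

-- s g m : sum of the base-g digits of m for g ≥ 2; s 0 m = s 1 m = 0
-- (s_1 := 0 as in the paper; g = 0 never occurs in the statement).
s : ℕ → ℕ → ℕ
s zero          m = 0
s (suc zero)    m = 0
s (suc (suc b)) m = digitSumAux m b m

record SDecomposition (m : ℕ) : Set where
  field
    factors    : List (ℕ × ℕ)
    nonempty   : ¬ (factors ≡ [])
    increasing : Linked _<_ (map proj₁ factors)
    valid      : All (λ { (g , e) → (1 < g) × (g < m) × (1 ≤ e) × (s g m ≥ g) }) factors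
    prod       : product (map (λ { (g , e) → g ^ e }) factors) ≡ m

record StrictSDecomposition (m : ℕ) : Set where
  field
    decomp : SDecomposition m
    strict : All (λ { (g , e) → s g m ≡ g }) (SDecomposition.factors decomp)

S' : ℕ → Set
S' m = SDecomposition m

S : ℕ → Set
S m = StrictSDecomposition m

Carmichael : ℕ → Set
Carmichael m = Composite m × (∀ a → Coprime a m → (+ m) ℤD.∣ ((+ (a ^ (m ∸ 1))) ℤ.- (+ 1)))

Squarefree : ℕ → Set
Squarefree m = ∀ p → Prime p → ¬ ((p * p) ∣ m)

C' : ℕ → Set
C' m = (1 < m) × Squarefree m × (∀ p → Prime p → p ∣ m → s p m ≡ p)

HasNPrimeFactors : ℕ → ℕ → Set
HasNPrimeFactors n m =
  Σ (List ℕ) λ ps → (length ps ≡ n) × Unique ps × All (λ p → Prime p × p ∣ m) ps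
                    × (∀ p → Prime p → p ∣ m → p ∈ ps)

Cₙ : ℕ → ℕ → Set
Cₙ n m = Carmichael m × HasNPrimeFactors n m

C'ₙ : ℕ → ℕ → Set
C'ₙ n m = C' m × HasNPrimeFactors n m

_⊆_ : (ℕ → Set) → (ℕ → Set) → Set
A ⊆ B = ∀ m → A m → B m

_⊂_ : (ℕ → Set) → (ℕ → Set) → Set
A ⊂ B = A ⊆ B × Σ ℕ (λ m → B m × ¬ A m)

_∩_ : (ℕ → Set) → (ℕ → Set) → (ℕ → Set)
(A ∩ B) m = A m × B m

_≐_ : (ℕ → Set) → (ℕ → Set) → Set
A ≐ B = A ⊆ B × B ⊆ A

{-# OPTIONS --safe #-}

-- Everything rests on Korselt's criterion, both directions of which follow from Fermat's
-- little theorem: a composite m is Carmichael iff it is squarefree and p − 1 ∣ m − 1 for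
-- every prime p ∣ m. Since s_p(m) ≡ m (mod p − 1), a Carmichael m has s_p(m) ≡ 1
-- (mod p − 1); and s_p(m) = s_p(m/p) ≥ 2 because m/p ≥ 2 is prime to p, so s_p(m) ≥ p and the
-- prime factorisation of m is an s-decomposition. For m ∈ 𝒞′ the equalities s_p(m) = p make
-- it strict and give Korselt's condition. Conversely let m ∈ 𝒮 ∩ 𝒞₃ and g a base of a strict
-- decomposition, m = g n. From s_g(n) = s_g(m) = g we get n ≥ g. If g were composite, n would
-- be prime (else m has four prime factors), and Korselt for n gives n − 1 ∣ g − 1, so n = g,
-- a contradiction; thus every base is prime and every prime p ∣ m is a base with s_p(m) = p.
-- The numbers 24 = 2³ · 3 and 172081 = 7 · 13 · 31 · 61 = 31 · 61 · 91 make the inclusions proper.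

module Submission where

open import Data.Empty using (⊥; ⊥-elim)
open import Data.Fin using (Fin; zero; suc)
open import Data.Fin.Properties using (injective⇒≤)
import Data.Integer.Base as ℤ
import Data.Integer.Divisibility as ℤD
open import Data.List using (List; []; _∷_; map; length; lookup)
open import Data.List.Membership.Propositional using (_∈_)
open import Data.List.Membership.Propositional.Properties using (∈-lookup; ∈-map⁺)
open import Data.List.Properties using (map-∘; map-id)
open import Data.List.Relation.Binary.Permutation.Propositional using (↭-sym)
open import Data.List.Relation.Binary.Permutation.Propositional.Properties using (All-resp-↭)
open import Data.List.Relation.Unary.All as All using (All; []; _∷_)
import Data.List.Relation.Unary.All.Properties as All
open import Data.List.Relation.Unary.AllPairs using ([]; _∷_)
open import Data.List.Relation.Unary.Any using (index; here; there)
open import Data.List.Relation.Unary.Any.Properties using (lookup-index)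
open import Data.List.Relation.Unary.Linked using (Linked; []; [-]; _∷_)
open import Data.List.Relation.Unary.Unique.Propositional using (Unique)
open import Data.Nat
open import Data.Nat.Combinatorics using (_C_; nCn≡1; nC1≡n; nCk≡nC[n∸k]; nCk+nC[k+1]≡[n+1]C[k+1]; k>n⇒nCk≡0)
open import Data.Nat.Coprimality using (Coprime; coprime-divisor)
open import Data.Nat.Divisibility
open import Data.Nat.DivMod
  using (_/_; _%_; m≡m%n+[m/n]*n; m%n<n; m/n<m; m*n%n≡0; m*n/n≡m; m<n⇒m%n≡m; m<n⇒m/n≡0; m≥n⇒m/n>0)
open import Data.Nat.Induction using (<-rec)
open import Data.Nat.ListAction using (product)
open import Data.Nat.ListAction.Properties using (product-↭; ∈⇒∣product)
open import Data.Nat.Primality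
  using ( Prime; prime?; Composite; composite; ¬prime[0]; ¬prime[1]; composite⇒¬prime; composite⇒nonZero
        ; ¬prime⇒composite; euclidsLemma; prime⇒irreducible; prime⇒nonTrivial)
open import Data.Nat.Primality.Factorisation using (PrimeFactorisation; factorise; factorisationHasAllPrimeFactors)
open import Data.Nat.Properties
open import Algebra.Properties.CommutativeSemigroup +-commutativeSemigroup using ()
  renaming (interchange to +-interchange; x∙yz≈y∙xz to m+[n+o]≡n+[m+o]; xy∙z≈xz∙y to [m+n]+o≡[m+o]+n)
open import Algebra.Properties.CommutativeSemigroup *-commutativeSemigroup using ()
  renaming (x∙yz≈y∙xz to m*[n*o]≡n*[m*o])
open import Data.List.Sort ≤-decTotalOrder using (sort; sort-↭; sort-↗)
open import Data.Nat.Tactic.RingSolver using (solve-∀)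
import Data.Product
open import Data.Product using (∃; _×_; _,_; proj₁; proj₂)
open import Data.Sum using (inj₁; inj₂; [_,_]′)
open import Function using (id; _∘_)
open import Relation.Binary.Bundles using (Setoid)
open import Relation.Binary.PropositionalEquality
import Relation.Binary.Reasoning.Setoid as SetoidReasoning
open import Relation.Binary.Structures using (IsEquivalence)
open import Relation.Nullary using (¬_; yes; no; contradiction)
open import Relation.Nullary.Decidable using (True; False; toWitness; toWitnessFalse; decidable-stable)

open import Defs

-- Congruence is stated additively, so that no truncated subtraction occurs.
infix 4 _≡_mod_

record _≡_mod_ (a b n : ℕ) : Set where
  constructor congruent
  field
    k l : ℕ
    balance : a + k * n ≡ b + l * n

module _ {n : ℕ} where

  mod-refl : ∀ {a} → a ≡ a mod n
  mod-refl = congruent 0 0 refl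

  ≡⇒≡mod : ∀ {a b} → a ≡ b → a ≡ b mod n
  ≡⇒≡mod refl = mod-refl

  mod-sym : ∀ {a b} → a ≡ b mod n → b ≡ a mod n
  mod-sym (congruent k l eq) = congruent l k (sym eq)

  mod-trans : ∀ {a b c} → a ≡ b mod n → b ≡ c mod n → a ≡ c mod n
  mod-trans {a} {b} {c} (congruent k l eq) (congruent k′ l′ eq′) = congruent (k + k′) (l + l′) (begin
    a + (k + k′) * n      ≡⟨ regroup a k k′ n ⟩
    (a + k * n) + k′ * n  ≡⟨ cong (_+ k′ * n) eq ⟩
    (b + l * n) + k′ * n  ≡⟨ swap b l k′ n ⟩
    (b + k′ * n) + l * n  ≡⟨ cong (_+ l * n) eq′ ⟩
    (c + l′ * n) + l * n  ≡⟨ swap c l′ l n ⟩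
    (c + l * n) + l′ * n  ≡⟨ regroup c l l′ n ⟨
    c + (l + l′) * n      ∎)
    where
    open ≡-Reasoning
    regroup : ∀ a k k′ n → a + (k + k′) * n ≡ (a + k * n) + k′ * n
    regroup = solve-∀
    swap : ∀ a k k′ n → (a + k * n) + k′ * n ≡ (a + k′ * n) + k * n
    swap = solve-∀

  +-mod : ∀ {a b c d} → a ≡ b mod n → c ≡ d mod n → a + c ≡ b + d mod n
  +-mod {a} {b} {c} {d} (congruent k l eq) (congruent k′ l′ eq′) = congruent (k + k′) (l + l′) (begin
    a + c + (k + k′) * n        ≡⟨ regroup a c k k′ n ⟩
    (a + k * n) + (c + k′ * n)  ≡⟨ cong₂ _+_ eq eq′ ⟩
    (b + l * n) + (d + l′ * n)  ≡⟨ regroup b d l l′ n ⟨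
    b + d + (l + l′) * n        ∎)
    where
    open ≡-Reasoning
    regroup : ∀ a c k k′ n → a + c + (k + k′) * n ≡ (a + k * n) + (c + k′ * n)
    regroup = solve-∀

  *-mod : ∀ {a b c d} → a ≡ b mod n → c ≡ d mod n → a * c ≡ b * d mod n
  *-mod {a} {b} {c} {d} (congruent k l eq) (congruent k′ l′ eq′) =
    congruent (a * k′ + k * c + k * k′ * n) (b * l′ + l * d + l * l′ * n) (begin
      a * c + (a * k′ + k * c + k * k′ * n) * n  ≡⟨ expand a c k k′ n ⟩
      (a + k * n) * (c + k′ * n)                 ≡⟨ cong₂ _*_ eq eq′ ⟩
      (b + l * n) * (d + l′ * n)                 ≡⟨ expand b d l l′ n ⟨
      b * d + (b * l′ + l * d + l * l′ * n) * n  ∎)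
    where
    open ≡-Reasoning
    expand : ∀ a c k k′ n → a * c + (a * k′ + k * c + k * k′ * n) * n ≡ (a + k * n) * (c + k′ * n)
    expand = solve-∀

  ^-mod : ∀ {a b} e → a ≡ b mod n → a ^ e ≡ b ^ e mod n
  ^-mod zero    _   = mod-refl
  ^-mod (suc e) a≡b = *-mod a≡b (^-mod e a≡b)

  +-cancelʳ-mod : ∀ {a b} c → a + c ≡ b + c mod n → a ≡ b mod n
  +-cancelʳ-mod {a} {b} c (congruent k l eq) = congruent k l (+-cancelʳ-≡ c _ _ (begin
    a + k * n + c  ≡⟨ [m+n]+o≡[m+o]+n a (k * n) c ⟩
    a + c + k * n  ≡⟨ eq ⟩
    b + c + l * n  ≡⟨ [m+n]+o≡[m+o]+n b c (l * n) ⟩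
    b + l * n + c  ∎))
    where open ≡-Reasoning

  ∣⇒≡0-mod : ∀ {a} → n ∣ a → a ≡ 0 mod n
  ∣⇒≡0-mod (divides q refl) = congruent 0 q (+-identityʳ _)

  ≡0-mod⇒∣ : ∀ {a} → a ≡ 0 mod n → n ∣ a
  ≡0-mod⇒∣ {a} (congruent k l eq) = divides (l ∸ k) (begin
    a                  ≡⟨ m+n∸n≡m a (k * n) ⟨
    a + k * n ∸ k * n  ≡⟨ cong (_∸ k * n) eq ⟩
    l * n ∸ k * n      ≡⟨ *-distribʳ-∸ n l k ⟨
    (l ∸ k) * n        ∎)
    where open ≡-Reasoning

  ∣∸⇒≡mod : ∀ {a b} → b ≤ a → n ∣ a ∸ b → a ≡ b mod n
  ∣∸⇒≡mod {a} {b} b≤a n∣a∸b = subst (_≡ b mod n) (m∸n+n≡m b≤a) (+-mod (∣⇒≡0-mod n∣a∸b) mod-refl)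

  ≡mod⇒∣∸ : ∀ {a b} → b ≤ a → a ≡ b mod n → n ∣ a ∸ b
  ≡mod⇒∣∸ {a} {b} b≤a a≡b =
    ≡0-mod⇒∣ (+-cancelʳ-mod b (subst (_≡ b mod n) (sym (m∸n+n≡m b≤a)) a≡b))

  ≡mod-∣ : ∀ {a b} → a ≡ b mod n → n ∣ b → n ∣ a
  ≡mod-∣ a≡b n∣b = ≡0-mod⇒∣ (mod-trans a≡b (∣⇒≡0-mod n∣b))

≡mod-weaken : ∀ {a b d n} → d ∣ n → a ≡ b mod n → a ≡ b mod d
≡mod-weaken {a} {b} {d} (divides q refl) (congruent k l eq) = congruent (k * q) (l * q)
  (trans (cong (a +_) (*-assoc k q d)) (trans eq (cong (b +_) (sym (*-assoc l q d)))))

mod-isEquivalence : ∀ n → IsEquivalence (λ a b → a ≡ b mod n)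
mod-isEquivalence n = record { refl = mod-refl ; sym = mod-sym ; trans = mod-trans }

mod-setoid : ℕ → Setoid _ _
mod-setoid n = record { isEquivalence = mod-isEquivalence n }

module ≡-mod-Reasoning (n : ℕ) = SetoidReasoning (mod-setoid n)

∑< : ℕ → (ℕ → ℕ) → ℕ
∑< zero    f = 0
∑< (suc n) f = ∑< n f + f n

syntax ∑< n (λ i → e) = ∑[ i < n ] e

∑-cong : ∀ n {f g} → (∀ i → i < n → f i ≡ g i) → ∑< n f ≡ ∑< n g
∑-cong zero    f≡g = refl
∑-cong (suc n) f≡g = cong₂ _+_ (∑-cong n (λ i i<n → f≡g i (m<n⇒m<1+n i<n))) (f≡g n ≤-refl)

∑-distrib-+ : ∀ n f g → ∑[ i < n ] (f i + g i) ≡ ∑< n f + ∑< n g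
∑-distrib-+ zero    f g = refl
∑-distrib-+ (suc n) f g rewrite ∑-distrib-+ n f g = +-interchange (∑< n f) (∑< n g) (f n) (g n)

*-distribˡ-∑ : ∀ n c f → c * ∑< n f ≡ ∑[ i < n ] (c * f i)
*-distribˡ-∑ zero    c f = *-zeroʳ c
*-distribˡ-∑ (suc n) c f rewrite sym (*-distribˡ-∑ n c f) = *-distribˡ-+ c (∑< n f) (f n)

∑-shift : ∀ n f → ∑< (suc n) f ≡ f 0 + ∑[ i < n ] f (suc i)
∑-shift zero    f = +-comm 0 (f 0)
∑-shift (suc n) f rewrite ∑-shift n f = +-assoc (f 0) _ _

∑-const : ∀ n c → ∑[ i < n ] c ≡ n * c
∑-const zero    c = refl
∑-const (suc n) c rewrite ∑-const n c = +-comm (n * c) c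

∑-comm : ∀ m n (f : ℕ → ℕ → ℕ) → ∑[ i < m ] ∑[ j < n ] f i j ≡ ∑[ j < n ] ∑[ i < m ] f i j
∑-comm zero    n f = sym (trans (∑-const n 0) (*-zeroʳ n))
∑-comm (suc m) n f rewrite ∑-comm m n f = sym (∑-distrib-+ n (λ j → ∑[ i < m ] f i j) (f m))

∑-∣ : ∀ {d} n f → (∀ i → i < n → d ∣ f i) → d ∣ ∑< n f
∑-∣ {d} zero f d∣f = d ∣0
∑-∣ (suc n) f d∣f = ∣m∣n⇒∣m+n (∑-∣ n f (λ i i<n → d∣f i (m<n⇒m<1+n i<n))) (d∣f n ≤-refl)

∑-mod : ∀ {d} n f g → (∀ i → i < n → f i ≡ g i mod d) → ∑< n f ≡ ∑< n g mod d
∑-mod zero    f g f≡g = mod-refl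
∑-mod (suc n) f g f≡g = +-mod (∑-mod n f g (λ i i<n → f≡g i (m<n⇒m<1+n i<n))) (f≡g n ≤-refl)

pascal : ∀ n k → suc n C suc k ≡ n C k + n C suc k
pascal n k = sym (nCk+nC[k+1]≡[n+1]C[k+1] n k)

C-absorption : ∀ n k → suc k * (suc n C suc k) ≡ suc n * (n C k)
C-absorption zero    zero    = refl
C-absorption zero    (suc k) = *-zeroʳ (2 + k)
C-absorption (suc n) zero    = trans (+-identityʳ _) (trans (nC1≡n (2 + n)) (sym (*-identityʳ (2 + n))))
C-absorption (suc n) (suc k) = begin
  (2 + k) * ((2 + n) C (2 + k))
    ≡⟨ cong ((2 + k) *_) (pascal (suc n) (suc k)) ⟩
  (2 + k) * (a + b)
    ≡⟨ split k a b ⟩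
  (1 + k) * a + a + (2 + k) * b
    ≡⟨ cong₂ (λ u v → u + a + v) (C-absorption n k) (C-absorption n (suc k)) ⟩
  (1 + n) * (n C k) + a + (1 + n) * (n C suc k)
    ≡⟨ collect n (n C k) a (n C suc k) ⟩
  (1 + n) * (n C k + n C suc k) + a
    ≡⟨ cong (λ u → (1 + n) * u + a) (pascal n k) ⟨
  (1 + n) * a + a
    ≡⟨ +-comm ((1 + n) * a) a ⟩
  (2 + n) * a ∎
  where
  open ≡-Reasoning
  a = (1 + n) C (1 + k)
  b = (1 + n) C (2 + k)
  split : ∀ k a b → (2 + k) * (a + b) ≡ (1 + k) * a + a + (2 + k) * b
  split = solve-∀
  collect : ∀ n c a d → (1 + n) * c + a + (1 + n) * d ≡ (1 + n) * (c + d) + a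
  collect = solve-∀

binomial-step : ∀ x n → ∑[ j < 2 + n ] ((suc n C j) * x ^ j) ≡ (1 + x) * ∑[ j < suc n ] ((n C j) * x ^ j)
binomial-step x n = begin
  ∑[ j < 2 + n ] ((suc n C j) * x ^ j)
    ≡⟨ ∑-shift (suc n) _ ⟩
  1 + ∑[ j < suc n ] ((suc n C suc j) * x ^ suc j)
    ≡⟨ cong (1 +_) (∑-cong (suc n) (λ j _ → cong (_* x ^ suc j) (pascal n j))) ⟩
  1 + ∑[ j < suc n ] ((n C j + n C suc j) * x ^ suc j)
    ≡⟨ cong (1 +_) (∑-cong (suc n) (λ j _ → *-distribʳ-+ (x ^ suc j) (n C j) (n C suc j))) ⟩
  1 + ∑[ j < suc n ] ((n C j) * x ^ suc j + (n C suc j) * x ^ suc j)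
    ≡⟨ cong (1 +_) (∑-distrib-+ (suc n) (λ j → (n C j) * x ^ suc j) (λ j → (n C suc j) * x ^ suc j)) ⟩
  1 + (∑[ j < suc n ] ((n C j) * x ^ suc j) + ∑[ j < suc n ] ((n C suc j) * x ^ suc j))
    ≡⟨ cong (λ u → 1 + (u + R)) lower ⟩
  1 + (x * B + R)
    ≡⟨ m+[n+o]≡n+[m+o] 1 (x * B) R ⟩
  x * B + (1 + R)
    ≡⟨ cong (x * B +_) upper ⟩
  x * B + B
    ≡⟨ +-comm (x * B) B ⟩
  (1 + x) * B ∎
  where
  open ≡-Reasoning
  B = ∑[ j < suc n ] ((n C j) * x ^ j)
  R = ∑[ j < suc n ] ((n C suc j) * x ^ suc j)
  lower : ∑[ j < suc n ] ((n C j) * x ^ suc j) ≡ x * B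
  lower = begin
    ∑[ j < suc n ] ((n C j) * x ^ suc j)    ≡⟨ ∑-cong (suc n) (λ j _ → m*[n*o]≡n*[m*o] (n C j) x (x ^ j)) ⟩
    ∑[ j < suc n ] (x * ((n C j) * x ^ j))  ≡⟨ *-distribˡ-∑ (suc n) x _ ⟨
    x * B                                   ∎
  upper : 1 + R ≡ B
  upper = begin
    1 + R                        ≡⟨ ∑-shift (suc n) (λ j → (n C j) * x ^ j) ⟨
    B + (n C suc n) * x ^ suc n  ≡⟨ cong (λ c → B + c * x ^ suc n) (k>n⇒nCk≡0 (n<1+n n)) ⟩
    B + 0                        ≡⟨ +-identityʳ B ⟩
    B                            ∎

binomial-theorem : ∀ x n → (1 + x) ^ n ≡ ∑[ j < suc n ] ((n C j) * x ^ j)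
binomial-theorem x zero    = refl
binomial-theorem x (suc n) = trans (cong ((1 + x) *_) (binomial-theorem x n)) (sym (binomial-step x n))

*-cancelʳ-mod : ∀ {p a b x} → Prime p → ¬ p ∣ x → a * x ≡ b * x mod p → a ≡ b mod p
*-cancelʳ-mod {p} {a} {b} {x} pp p∤x ax≡bx =
  [ cancel ax≡bx , mod-sym ∘ cancel (mod-sym ax≡bx) ]′ (≤-total b a)
  where
  cancel : ∀ {c d} → c * x ≡ d * x mod p → d ≤ c → c ≡ d mod p
  cancel {c} {d} cx≡dx d≤c = ∣∸⇒≡mod d≤c ([ id , ⊥-elim ∘ p∤x ]′ (euclidsLemma (c ∸ d) x pp p∣[c∸d]x))
    where
    p∣[c∸d]x : p ∣ (c ∸ d) * x
    p∣[c∸d]x = subst (p ∣_) (sym (*-distribʳ-∸ x c d)) (≡mod⇒∣∸ (*-monoˡ-≤ x d≤c) cx≡dx)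

prime∣C : ∀ {p k} → Prime p → 0 < k → k < p → p ∣ p C k
prime∣C {suc p′} {suc k′} pp _ k<p =
  [ ⊥-elim ∘ >⇒∤ k<p , id ]′ (euclidsLemma (suc k′) (suc p′ C suc k′) pp p∣k[pCk])
  where
  p∣k[pCk] : suc p′ ∣ suc k′ * (suc p′ C suc k′)
  p∣k[pCk] = subst (suc p′ ∣_) (sym (C-absorption p′ k′)) (m∣m*n (p′ C k′))

fermat : ∀ {p} → Prime p → ∀ x → x ^ p ≡ x mod p
fermat {suc p′} pp zero    = mod-refl
fermat {p@(suc p′)} pp (suc x) = begin
  (1 + x) ^ p
    ≡⟨ binomial-theorem x p ⟩
  ∑[ j < 1 + p ] ((p C j) * x ^ j)
    ≡⟨ cong (_+ (p C p) * x ^ p) (∑-shift p′ (λ j → (p C j) * x ^ j)) ⟩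
  1 + ∑[ j < p′ ] ((p C suc j) * x ^ suc j) + (p C p) * x ^ p
    ≈⟨ +-mod (+-mod (mod-refl {a = 1}) middle) top ⟩
  1 + 0 + x ∎
  where
  open ≡-mod-Reasoning p
  middle : ∑[ j < p′ ] ((p C suc j) * x ^ suc j) ≡ 0 mod p
  middle = ∣⇒≡0-mod (∑-∣ p′ _ (λ j j<p′ → ∣m⇒∣m*n (x ^ suc j) (prime∣C pp z<s (s<s j<p′))))
  top : (p C p) * x ^ p ≡ x mod p
  top = mod-trans (≡⇒≡mod (trans (cong (_* x ^ p) (nCn≡1 p)) (*-identityˡ (x ^ p)))) (fermat pp x)

fermat-unit : ∀ {p x} → Prime p → ¬ p ∣ x → x ^ (p ∸ 1) ≡ 1 mod p
fermat-unit {suc p′} {x} pp p∤x = *-cancelʳ-mod pp p∤x (begin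
  x ^ p′ * x  ≡⟨ *-comm (x ^ p′) x ⟩
  x ^ suc p′  ≈⟨ fermat pp x ⟩
  x           ≡⟨ *-identityˡ x ⟨
  1 * x       ∎)
  where open ≡-mod-Reasoning (suc p′)

[1+n]Cn≡1+n : ∀ n → suc n C n ≡ suc n
[1+n]Cn≡1+n n = trans (nCk≡nC[n∸k] (n≤1+n n)) (trans (cong (suc n C_) (m+n∸n≡m 1 n)) (nC1≡n (suc n)))

powerSum : ℕ → ℕ → ℕ
powerSum p j = ∑[ x < p ] (x ^ j)

powerSum-recurrence : ∀ p K → ∑[ j < suc K ] ((suc K C j) * powerSum p j) ≡ p ^ suc K
powerSum-recurrence p K = +-cancelʳ-≡ (powerSum p (suc K)) _ _ (begin
  ∑[ j < suc K ] ((suc K C j) * powerSum p j) + powerSum p (suc K)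
    ≡⟨ cong (∑[ j < suc K ] ((suc K C j) * powerSum p j) +_) (sym top) ⟩
  ∑[ j < 2 + K ] ((suc K C j) * powerSum p j)
    ≡⟨ ∑-cong (2 + K) (λ j _ → *-distribˡ-∑ p (suc K C j) (_^ j)) ⟩
  ∑[ j < 2 + K ] ∑[ x < p ] ((suc K C j) * x ^ j)
    ≡⟨ ∑-comm (2 + K) p (λ j x → (suc K C j) * x ^ j) ⟩
  ∑[ x < p ] ∑[ j < 2 + K ] ((suc K C j) * x ^ j)
    ≡⟨ ∑-cong p (λ x _ → binomial-theorem x (suc K)) ⟨
  ∑[ x < p ] ((1 + x) ^ suc K)
    ≡⟨ ∑-shift p (_^ suc K) ⟨
  powerSum p (suc K) + p ^ suc K
    ≡⟨ +-comm (powerSum p (suc K)) (p ^ suc K) ⟩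
  p ^ suc K + powerSum p (suc K) ∎)
  where
  open ≡-Reasoning
  top : (suc K C suc K) * powerSum p (suc K) ≡ powerSum p (suc K)
  top = trans (cong (_* powerSum p (suc K)) (nCn≡1 (suc K))) (*-identityˡ _)

p∣powerSum : ∀ {p} → Prime p → ∀ j → suc j < p → p ∣ powerSum p j
p∣powerSum {p} pp = <-rec (λ j → suc j < p → p ∣ powerSum p j) step
  where
  step : ∀ K → (∀ {i} → i < K → suc i < p → p ∣ powerSum p i) → suc K < p → p ∣ powerSum p K
  step K rec 1+K<p = [ ⊥-elim ∘ >⇒∤ 1+K<p , id ]′ (euclidsLemma (suc K) (powerSum p K) pp p∣[1+K]S)
    where
    lower : p ∣ ∑[ j < K ] ((suc K C j) * powerSum p j)
    lower = ∑-∣ K _ (λ j j<K → ∣n⇒∣m*n (suc K C j) (rec j<K (<-trans (s<s j<K) 1+K<p)))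
    whole : p ∣ ∑[ j < suc K ] ((suc K C j) * powerSum p j)
    whole = subst (p ∣_) (sym (powerSum-recurrence p K)) (∣m⇒∣m*n (p ^ K) ∣-refl)
    p∣[1+K]S : p ∣ suc K * powerSum p K
    p∣[1+K]S = subst (λ c → p ∣ c * powerSum p K) ([1+n]Cn≡1+n K) (∣m+n∣m⇒∣n whole lower)

powerSum-units : ∀ {p r} → Prime p → 0 < r → (∀ x → 0 < x → x < p → x ^ r ≡ 1 mod p) →
                 powerSum p r ≡ p ∸ 1 mod p
powerSum-units {suc p′} {suc r′} pp _ xʳ≡1 = begin
  powerSum (suc p′) (suc r′)      ≡⟨ ∑-shift p′ (_^ suc r′) ⟩
  ∑[ x < p′ ] ((1 + x) ^ suc r′)  ≈⟨ ∑-mod p′ _ _ (λ x x<p′ → xʳ≡1 (suc x) z<s (s<s x<p′)) ⟩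
  ∑[ x < p′ ] 1                   ≡⟨ trans (∑-const p′ 1) (*-identityʳ p′) ⟩
  p′                              ∎
  where open ≡-mod-Reasoning (suc p′)

^-reduce-mod : ∀ {p x} → Prime p → ¬ p ∣ x → ∀ r q → x ^ (r + q * (p ∸ 1)) ≡ x ^ r mod p
^-reduce-mod {p} {x} pp p∤x r q = begin
  x ^ (r + q * (p ∸ 1))      ≡⟨ ^-distribˡ-+-* x r (q * (p ∸ 1)) ⟩
  x ^ r * x ^ (q * (p ∸ 1))  ≡⟨ cong (λ e → x ^ r * x ^ e) (*-comm q (p ∸ 1)) ⟩
  x ^ r * x ^ ((p ∸ 1) * q)  ≡⟨ cong (x ^ r *_) (^-*-assoc x (p ∸ 1) q) ⟨
  x ^ r * (x ^ (p ∸ 1)) ^ q  ≈⟨ *-mod (mod-refl {a = x ^ r}) (^-mod q (fermat-unit pp p∤x)) ⟩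
  x ^ r * 1 ^ q              ≡⟨ cong (x ^ r *_) (^-zeroˡ q) ⟩
  x ^ r * 1                  ≡⟨ *-identityʳ (x ^ r) ⟩
  x ^ r                      ∎
  where open ≡-mod-Reasoning p

-- In place of a primitive root: for 0 < r < p − 1 the power sum ∑ xʳ over x < p vanishes
-- mod p, whereas it is ≡ p − 1 if xʳ ≡ 1 for every unit x.
p∸1∣exponent : ∀ {p e} → Prime p → (∀ x → 0 < x → x < p → x ^ e ≡ 1 mod p) → (p ∸ 1) ∣ e
p∸1∣exponent {2+ b} {e} pp xᵉ≡1 with e % suc b in e%≡
... | zero   = m%n≡0⇒n∣m e (suc b) e%≡
... | suc r′ = ⊥-elim (>⇒∤ (n<1+n (suc b)) p∣p∸1)
  where
  e≡ : e ≡ suc r′ + e / suc b * suc b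
  e≡ = trans (m≡m%n+[m/n]*n e (suc b)) (cong (_+ e / suc b * suc b) e%≡)
  xʳ≡1 : ∀ x → 0 < x → x < 2+ b → x ^ suc r′ ≡ 1 mod 2+ b
  xʳ≡1 x 0<x x<p = mod-trans (mod-sym (subst (λ n → x ^ n ≡ x ^ suc r′ mod 2+ b) (sym e≡) xᵉ≡xʳ)) (xᵉ≡1 x 0<x x<p)
    where
    xᵉ≡xʳ : x ^ (suc r′ + e / suc b * suc b) ≡ x ^ suc r′ mod 2+ b
    xᵉ≡xʳ = ^-reduce-mod pp (>⇒∤ {{>-nonZero 0<x}} x<p) (suc r′) (e / suc b)
  p∣p∸1 : 2+ b ∣ suc b
  p∣p∸1 = ≡mod-∣ (mod-sym (powerSum-units {r = suc r′} pp z<s xʳ≡1))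
                 (p∣powerSum pp (suc r′) (s<s (subst (_< suc b) e%≡ (m%n<n e (suc b)))))

prime>1 : ∀ {p} → Prime p → 1 < p
prime>1 {p} pp = nonTrivial⇒n>1 p {{prime⇒nonTrivial pp}}

composite>1 : ∀ {m} → Composite m → 1 < m
composite>1 (composite {d} d<m _) = <-trans (nonTrivial⇒n>1 d) d<m

∣∧∣pred⇒∣1 : ∀ {d m} → 0 < m → d ∣ m → d ∣ m ∸ 1 → d ∣ 1
∣∧∣pred⇒∣1 {d} 0<m d∣m d∣m∸1 = ∣m+n∣m⇒∣n (subst (d ∣_) (sym (m∸n+n≡m 0<m)) d∣m) d∣m∸1

coprime-suc : ∀ {a n} → n ∣ a → Coprime (suc a) n
coprime-suc {a} n∣a {d} (d∣1+a , d∣n) = ∣1⇒≡1 (∣m+n∣m⇒∣n (subst (d ∣_) (+-comm 1 a) d∣1+a) (∣-trans d∣n n∣a))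

coprime-*ʳ-prime : ∀ {a p n} → Prime p → ¬ p ∣ a → Coprime a n → Coprime a (p * n)
coprime-*ʳ-prime {a} {p} pp p∤a a⊥n {d} (d∣a , d∣pn) = a⊥n (d∣a , coprime-divisor d⊥p d∣pn)
  where
  d⊥p : Coprime d p
  d⊥p {e} (e∣d , e∣p) with prime⇒irreducible pp e∣p
  ... | inj₁ e≡1  = e≡1
  ... | inj₂ refl = ⊥-elim (p∤a (∣-trans e∣d d∣a))

squarefree-∣ : ∀ {d m} → d ∣ m → Squarefree m → Squarefree d
squarefree-∣ d∣m sq p pp pp∣d = sq p pp (∣-trans pp∣d d∣m)

squarefree⇒≢ : ∀ {m x y} → Squarefree m → Prime x → x * y ∣ m → x ≢ y
squarefree⇒≢ sq px xy∣m refl = sq _ px xy∣m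

record IncreasingPrimeFactorisation (m : ℕ) : Set where
  field
    primes     : List ℕ
    increasing : Linked _<_ primes
    allPrime   : All Prime primes
    product≡   : product primes ≡ m

squarefree-sorted⇒increasing : ∀ {ps} → Squarefree (product ps) → All Prime ps → Linked _≤_ ps → Linked _<_ ps
squarefree-sorted⇒increasing sq _ [] = []
squarefree-sorted⇒increasing sq _ [-] = [-]
squarefree-sorted⇒increasing {x ∷ y ∷ ps} sq (px ∷ pys) (x≤y ∷ sorted) =
  ≤∧≢⇒< x≤y (squarefree⇒≢ sq px (*-monoʳ-∣ x (m∣m*n (product ps))))
  ∷ squarefree-sorted⇒increasing (squarefree-∣ (n∣m*n x) sq) pys sorted

sortPrimeFactorisation : ∀ {m} → Squarefree m → PrimeFactorisation m → IncreasingPrimeFactorisation m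
sortPrimeFactorisation {m} sq F = record
  { primes     = sort factors
  ; increasing = squarefree-sorted⇒increasing (subst Squarefree (sym sorted≡m) sq) allPrime (sort-↗ factors)
  ; allPrime   = allPrime
  ; product≡   = sorted≡m
  }
  where
  open PrimeFactorisation F
  sorted≡m : product (sort factors) ≡ m
  sorted≡m = trans (product-↭ (sort-↭ factors)) (sym isFactorisation)
  allPrime : All Prime (sort factors)
  allPrime = All-resp-↭ (↭-sym (sort-↭ factors)) factorsPrime

squarefreeFactorisation : ∀ {m} → .{{NonZero m}} → Squarefree m → IncreasingPrimeFactorisation m
squarefreeFactorisation {m} sq = sortPrimeFactorisation sq (factorise m)

primes-∣ : ∀ {m} (F : IncreasingPrimeFactorisation m) → All (_∣ m) (IncreasingPrimeFactorisation.primes F)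
primes-∣ F = subst (λ n → All (_∣ n) primes) product≡ (All.tabulate ∈⇒∣product)
  where open IncreasingPrimeFactorisation F

squarefree-product-∣ : ∀ {N} ps → Squarefree (product ps) → All Prime ps → All (_∣ N) ps → product ps ∣ N
squarefree-product-∣ {N} []       _  _          _           = 1∣ N
squarefree-product-∣ {N} (p ∷ ps) sq (pp ∷ pps) (p∣N ∷ ps∣N)
  with divides t N≡tP ← squarefree-product-∣ ps (squarefree-∣ (n∣m*n p) sq) pps ps∣N =
  subst (p * P ∣_) (sym N≡tP) (*-monoˡ-∣ P (coprime-divisor p⊥P (subst (p ∣_) (trans N≡tP (*-comm t P)) p∣N)))
  where
  P = product ps
  p⊥P : Coprime p P
  p⊥P {d} (d∣p , d∣P) with prime⇒irreducible pp d∣p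
  ... | inj₁ d≡1  = d≡1
  ... | inj₂ refl = ⊥-elim (sq p pp (*-monoʳ-∣ p d∣P))

squarefree-∣-by-primes : ∀ {m N} → .{{NonZero m}} → Squarefree m → (∀ p → Prime p → p ∣ m → p ∣ N) → m ∣ N
squarefree-∣-by-primes {m} sq primes∣N = subst (_∣ _) product≡
  (squarefree-product-∣ primes (subst Squarefree (sym product≡) sq) allPrime
    (All.zipWith (λ (pp , p∣m) → primes∣N _ pp p∣m) (allPrime , primes-∣ F)))
  where
  F = squarefreeFactorisation sq
  open IncreasingPrimeFactorisation F

carmichael>1 : ∀ {m} → Carmichael m → 1 < m
carmichael>1 = composite>1 ∘ proj₁

carmichael-≡1 : ∀ {m a} → Carmichael m → Coprime a m → a ^ (m ∸ 1) ≡ 1 mod m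
carmichael-≡1 {m} {a} carm@(_ , m∣aᵐ⁻¹-1) a⊥m with a ^ (m ∸ 1) | m∣aᵐ⁻¹-1 a a⊥m
... | zero  | m∣1 = ⊥-elim (<⇒≢ (carmichael>1 carm) (sym (∣1⇒≡1 m∣1)))
... | suc y | m∣y = +-mod {a = 1} {b = 1} mod-refl (∣⇒≡0-mod m∣y)

≡1-mod⇒ℤ∣ : ∀ {m x} → 1 < m → x ≡ 1 mod m → ℤ.+ m ℤD.∣ (ℤ.+ x ℤ.- ℤ.+ 1)
≡1-mod⇒ℤ∣ {x = zero}  1<m 0≡1 = ⊥-elim (<⇒≢ 1<m (sym (∣1⇒≡1 (≡0-mod⇒∣ (mod-sym 0≡1)))))
≡1-mod⇒ℤ∣ {x = suc y} 1<m x≡1 = ≡mod⇒∣∸ (s≤s z≤n) x≡1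

[1+k]^j≡1+jk : ∀ {m} k j → m ∣ k * k → (1 + k) ^ j ≡ 1 + j * k mod m
[1+k]^j≡1+jk k zero    _     = mod-refl
[1+k]^j≡1+jk {m} k (suc j) m∣k² = begin
  (1 + k) * (1 + k) ^ j        ≈⟨ *-mod (mod-refl {a = 1 + k}) ([1+k]^j≡1+jk k j m∣k²) ⟩
  (1 + k) * (1 + j * k)        ≡⟨ expand k j ⟩
  1 + suc j * k + j * (k * k)  ≈⟨ +-mod (mod-refl {a = 1 + suc j * k}) (∣⇒≡0-mod (∣n⇒∣m*n j m∣k²)) ⟩
  1 + suc j * k + 0            ≡⟨ +-identityʳ _ ⟩
  1 + suc j * k                ∎
  where
  open ≡-mod-Reasoning m
  expand : ∀ k j → (1 + k) * (1 + j * k) ≡ 1 + suc j * k + j * (k * k)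
  expand = solve-∀

∣k²⇒coprime[1+k] : ∀ {m k} → m ∣ k * k → Coprime (1 + k) m
∣k²⇒coprime[1+k] {m} {k} m∣k² {d} (d∣1+k , d∣m) = coprime-suc d∣k (d∣1+k , ∣-refl)
  where
  d⊥k : Coprime d k
  d⊥k (e∣d , e∣k) = coprime-suc ∣-refl (∣-trans e∣d d∣1+k , e∣k)
  d∣k : d ∣ k
  d∣k = coprime-divisor d⊥k (∣-trans d∣m m∣k²)

-- If p² ∣ m then k = m/p has m ∣ k², so 1 + k is a unit with (1 + k)^(m−1) ≡ 1 + (m − 1)k,
-- which forces p ∣ m − 1.
carmichael⇒squarefree : ∀ {m} → Carmichael m → Squarefree m
carmichael⇒squarefree {m} carm p pp (divides t m≡t[pp]) = ⊥-elim (<⇒≢ (prime>1 pp) (sym (∣1⇒≡1 p∣1)))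
  where
  k = t * p
  m≡kp : m ≡ k * p
  m≡kp = trans m≡t[pp] (sym (*-assoc t p p))
  m∣k² : m ∣ k * k
  m∣k² = divides t (trans (rearrange t p) (cong (t *_) (sym m≡t[pp])))
    where
    rearrange : ∀ t p → t * p * (t * p) ≡ t * (t * (p * p))
    rearrange = solve-∀
  1+[m∸1]k≡1 : 1 + (m ∸ 1) * k ≡ 1 mod m
  1+[m∸1]k≡1 = mod-trans (mod-sym ([1+k]^j≡1+jk k (m ∸ 1) m∣k²)) (carmichael-≡1 carm (∣k²⇒coprime[1+k] m∣k²))
  m∣[m∸1]k : m ∣ (m ∸ 1) * k
  m∣[m∸1]k = ≡0-mod⇒∣ (+-cancelʳ-mod 1 (subst₂ (_≡_mod m) (+-comm 1 _) refl 1+[m∸1]k≡1))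
  instance
    k≢0 : NonZero k
    k≢0 = m*n≢0⇒m≢0 k {{subst NonZero m≡kp (>-nonZero (<-trans z<s (carmichael>1 carm)))}}
  p∣m∸1 : p ∣ m ∸ 1
  p∣m∸1 = *-cancelʳ-∣ k (subst (_∣ (m ∸ 1) * k) (trans m≡kp (*-comm k p)) m∣[m∸1]k)
  p∣1 : p ∣ 1
  p∣1 = ∣∧∣pred⇒∣1 (<-trans z<s (carmichael>1 carm)) (divides k m≡kp) p∣m∸1

carmichael⇒korselt : ∀ {m p} → Carmichael m → Prime p → p ∣ m → (p ∸ 1) ∣ (m ∸ 1)
carmichael⇒korselt {m} {p} carm pp (divides n m≡np) = p∸1∣exponent pp xᵐ⁻¹≡1
  where
  p∤n : ¬ p ∣ n
  p∤n p∣n = carmichael⇒squarefree carm p pp (subst (p * p ∣_) (sym m≡np) (*-monoˡ-∣ p p∣n))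
  u = n ^ (p ∸ 2)
  nu≡1 : n * u ≡ 1 mod p
  nu≡1 = subst (λ e → n ^ e ≡ 1 mod p) (+-∸-assoc 1 (prime>1 pp)) (fermat-unit pp p∤n)
  xᵐ⁻¹≡1 : ∀ x → 0 < x → x < p → x ^ (m ∸ 1) ≡ 1 mod p
  xᵐ⁻¹≡1 x 0<x x<p = begin
    x ^ (m ∸ 1)  ≈⟨ ^-mod (m ∸ 1) (mod-sym a≡x) ⟩
    a ^ (m ∸ 1)  ≈⟨ ≡mod-weaken (divides n m≡np) (carmichael-≡1 carm a⊥m) ⟩
    1            ∎
    where
    open ≡-mod-Reasoning p
    -- a ≡ x (mod p) and a ≡ 1 (mod n), where u inverts n = m/p modulo p.
    a = 1 + n * (u * (x ∸ 1))
    a≡x : a ≡ x mod p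
    a≡x = begin
      1 + n * (u * (x ∸ 1))  ≡⟨ cong (1 +_) (*-assoc n u (x ∸ 1)) ⟨
      1 + n * u * (x ∸ 1)    ≈⟨ +-mod (mod-refl {a = 1}) (*-mod nu≡1 (mod-refl {a = x ∸ 1})) ⟩
      1 + 1 * (x ∸ 1)        ≡⟨ cong (1 +_) (*-identityˡ (x ∸ 1)) ⟩
      1 + (x ∸ 1)            ≡⟨ m+[n∸m]≡n 0<x ⟩
      x                      ∎
    p∤a : ¬ p ∣ a
    p∤a p∣a = >⇒∤ {{>-nonZero 0<x}} x<p (≡mod-∣ (mod-sym a≡x) p∣a)
    a⊥m : Coprime a m
    a⊥m = subst (Coprime a) (trans (*-comm p n) (sym m≡np))
                (coprime-*ʳ-prime pp p∤a (coprime-suc (m∣m*n (u * (x ∸ 1)))))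

korselt⇒carmichael : ∀ {m} → Composite m → Squarefree m → (∀ p → Prime p → p ∣ m → (p ∸ 1) ∣ (m ∸ 1)) → Carmichael m
korselt⇒carmichael {m} m-composite sq korselt = m-composite , λ a a⊥m → ≡1-mod⇒ℤ∣ 1<m (aᵐ⁻¹≡1 a a⊥m)
  where
  1<m : 1 < m
  1<m = composite>1 m-composite
  instance
    m≢0 : NonZero m
    m≢0 = >-nonZero (<-trans z<s 1<m)
  aᵐ⁻¹≡1 : ∀ a → Coprime a m → a ^ (m ∸ 1) ≡ 1 mod m
  aᵐ⁻¹≡1 zero    0⊥m = ⊥-elim (<⇒≢ 1<m (sym (0⊥m (m ∣0 , ∣-refl))))
  aᵐ⁻¹≡1 (suc a) a⊥m = ∣∸⇒≡mod 1≤aᵐ⁻¹ (squarefree-∣-by-primes sq p∣aᵐ⁻¹∸1)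
    where
    1≤aᵐ⁻¹ : 1 ≤ suc a ^ (m ∸ 1)
    1≤aᵐ⁻¹ = m^n>0 (suc a) (m ∸ 1)
    p∣aᵐ⁻¹∸1 : ∀ p → Prime p → p ∣ m → p ∣ suc a ^ (m ∸ 1) ∸ 1
    p∣aᵐ⁻¹∸1 p pp p∣m with divides q m∸1≡q[p∸1] ← korselt p pp p∣m =
      ≡mod⇒∣∸ 1≤aᵐ⁻¹ (subst (λ e → suc a ^ e ≡ 1 mod p) (sym m∸1≡q[p∸1]) (^-reduce-mod pp p∤a 0 q))
      where
      p∤a : ¬ p ∣ suc a
      p∤a p∣a = <⇒≢ (prime>1 pp) (sym (a⊥m (p∣a , p∣m)))

[1+m]/[2+b]≤m : ∀ b m → suc m / 2+ b ≤ m
[1+m]/[2+b]≤m b m = ≤-pred (m/n<m (suc m) (2+ b) (s≤s (s≤s z≤n)))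

digitSumAux-0 : ∀ f b → digitSumAux f b 0 ≡ 0
digitSumAux-0 zero    b = refl
digitSumAux-0 (suc f) b = refl

digitSumAux-fuel : ∀ b m f₁ f₂ → m ≤ f₁ → m ≤ f₂ → digitSumAux f₁ b m ≡ digitSumAux f₂ b m
digitSumAux-fuel b zero    f₁       f₂       _         _         = trans (digitSumAux-0 f₁ b) (sym (digitSumAux-0 f₂ b))
digitSumAux-fuel b (suc m) (suc f₁) (suc f₂) (s≤s m≤f₁) (s≤s m≤f₂) = cong (suc m % 2+ b +_)
  (digitSumAux-fuel b (suc m / 2+ b) f₁ f₂ (≤-trans ([1+m]/[2+b]≤m b m) m≤f₁) (≤-trans ([1+m]/[2+b]≤m b m) m≤f₂))

digitSumAux-≡mod : ∀ b m f → m ≤ f → digitSumAux f b m ≡ m mod suc b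
digitSumAux-≡mod b zero    f       _       = ≡⇒≡mod (digitSumAux-0 f b)
digitSumAux-≡mod b (suc m) (suc f) (s≤s m≤f) = begin
  r + digitSumAux f b q  ≈⟨ +-mod (mod-refl {a = r}) (digitSumAux-≡mod b q f (≤-trans ([1+m]/[2+b]≤m b m) m≤f)) ⟩
  r + q                  ≈⟨ +-mod (mod-refl {a = r}) q*g≡q ⟨
  r + q * 2+ b           ≡⟨ m≡m%n+[m/n]*n (suc m) (2+ b) ⟨
  suc m                  ∎
  where
  open ≡-mod-Reasoning (suc b)
  r = suc m % 2+ b
  q = suc m / 2+ b
  q*g≡q : q * 2+ b ≡ q mod suc b
  q*g≡q = congruent 0 q (trans (+-identityʳ _) (*-suc q (suc b)))

s-≡mod : ∀ b m → s (2+ b) m ≡ m mod suc b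
s-≡mod b m = digitSumAux-≡mod b m m ≤-refl

s-unfold : ∀ b m → s (2+ b) m ≡ m % 2+ b + s (2+ b) (m / 2+ b)
s-unfold b zero    = refl
s-unfold b (suc m) = cong (suc m % 2+ b +_) (digitSumAux-fuel b _ m _ ([1+m]/[2+b]≤m b m) ≤-refl)

s-*base : ∀ b n → s (2+ b) (2+ b * n) ≡ s (2+ b) n
s-*base b n = begin
  s g (g * n)                             ≡⟨ s-unfold b (g * n) ⟩
  g * n % g + s g (g * n / g)             ≡⟨ cong₂ (λ r q → r + s g q) (trans (cong (_% g) (*-comm g n)) (m*n%n≡0 n g))
                                                                    (trans (cong (_/ g) (*-comm g n)) (m*n/n≡m n g)) ⟩
  s g n                                   ∎
  where
  open ≡-Reasoning
  g = 2+ b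

s-<base : ∀ b {n} → n < 2+ b → s (2+ b) n ≡ n
s-<base b {n} n<g = trans (s-unfold b n) (trans (cong₂ (λ r q → r + s (2+ b) q) (m<n⇒m%n≡m n<g) (m<n⇒m/n≡0 n<g)) (+-identityʳ n))

s-self : ∀ b → s (2+ b) (2+ b) ≡ 1
s-self b = trans (cong (s (2+ b)) (sym (*-identityʳ (2+ b)))) (s-*base b 1)

s[g]g≢g : ∀ {g} → 1 < g → s g g ≢ g
s[g]g≢g {2+ b} _ sᵍg≡g with () ← trans (sym (s-self b)) sᵍg≡g

s-positive : ∀ b {n} → 0 < n → 0 < s (2+ b) n
s-positive b {n} = <-rec (λ n → 0 < n → 0 < s g n) step n
  where
  g = 2+ b
  step : ∀ n → (∀ {k} → k < n → 0 < k → 0 < s g k) → 0 < n → 0 < s g n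
  step n rec 0<n with n % g in n%g≡
  ... | suc r = subst (0 <_) (sym (trans (s-unfold b n) (cong (_+ s g (n / g)) n%g≡))) z<s
  ... | zero  = subst (0 <_) (sym (trans (s-unfold b n) (cong (_+ s g (n / g)) n%g≡)))
                  (rec (m/n<m n g {{>-nonZero 0<n}} (s≤s (s≤s z≤n))) (m≥n⇒m/n>0 g≤n))
    where
    g≤n : g ≤ n
    g≤n = ∣⇒≤ {{>-nonZero 0<n}} (m%n≡0⇒n∣m n g n%g≡)

s-≥2 : ∀ b {n} → 2 ≤ n → ¬ 2+ b ∣ n → 2 ≤ s (2+ b) n
s-≥2 b {n} 2≤n g∤n with n <? 2+ b
... | yes n<g = subst (2 ≤_) (sym (s-<base b n<g)) 2≤n
... | no  n≮g = subst (2 ≤_) (sym (s-unfold b n)) (+-mono-≤ 1≤n%g (s-positive b (m≥n⇒m/n>0 (≮⇒≥ n≮g))))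
  where
  1≤n%g : 1 ≤ n % 2+ b
  1≤n%g with n % 2+ b in n%g≡
  ... | zero  = ⊥-elim (g∤n (m%n≡0⇒n∣m n (2+ b) n%g≡))
  ... | suc _ = s≤s z≤n

module _ {m} (1<m : 1 < m) (F : IncreasingPrimeFactorisation m) where
  open IncreasingPrimeFactorisation F

  private
    prime-divisors : All (λ p → Prime p × p ∣ m) primes
    prime-divisors = All.zip (allPrime , primes-∣ F)

    product-map-pairs : ∀ (f : ℕ × ℕ → ℕ) → (∀ p → f (p , 1) ≡ p) → ∀ ps →
                        product (map f (map (_, 1) ps)) ≡ product ps
    product-map-pairs f f[p,1]≡p []       = refl
    product-map-pairs f f[p,1]≡p (p ∷ ps) = cong₂ _*_ (f[p,1]≡p p) (product-map-pairs f f[p,1]≡p ps)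

  primeDecomposition : (∀ p → Prime p → p ∣ m → p < m × p ≤ s p m) → S' m
  primeDecomposition bound = record
    { factors    = map (_, 1) primes
    ; nonempty   = nonempty
    ; increasing = subst (Linked _<_) (sym (trans (sym (map-∘ primes)) (map-id primes))) increasing
    ; valid      = All.map⁺ (All.map (λ (pp , p∣m) → valid (bound _ pp p∣m) pp) prime-divisors)
    ; prod       = trans (product-map-pairs _ *-identityʳ primes) product≡
    }
    where
    valid : ∀ {p} → p < m × p ≤ s p m → Prime p → 1 < p × p < m × 1 ≤ 1 × p ≤ s p m
    valid (p<m , p≤sᵖm) pp = prime>1 pp , p<m , ≤-refl , p≤sᵖm
    nonempty : ¬ (map (_, 1) primes ≡ [])
    nonempty map≡[] with primes | product≡
    nonempty () | _ ∷ _ | _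
    ... | [] | 1≡m = <⇒≢ 1<m 1≡m

  strictPrimeDecomposition : (∀ p → Prime p → p ∣ m → p < m × s p m ≡ p) → S m
  strictPrimeDecomposition strict = record
    { decomp = primeDecomposition (λ p pp p∣m → Data.Product.map₂ (≤-reflexive ∘ sym) (strict p pp p∣m))
    ; strict = All.map⁺ (All.map (λ (pp , p∣m) → proj₂ (strict _ pp p∣m)) prime-divisors)
    }

primeDivisor<composite : ∀ {m p} → Composite m → Prime p → p ∣ m → p < m
primeDivisor<composite m-composite pp p∣m =
  ≤∧≢⇒< (∣⇒≤ {{composite⇒nonZero m-composite}} p∣m) (λ { refl → composite⇒¬prime m-composite pp })

≡1-mod⇒< : ∀ {d t} → 1 < t → t ≡ 1 mod d → d < t
≡1-mod⇒< {d} {suc t} (s≤s 0<t) t≡1 = s≤s (∣⇒≤ {{>-nonZero 0<t}} (≡mod⇒∣∸ (s≤s z≤n) t≡1))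

carmichael⇒p≤sᵖ : ∀ {m p} → Carmichael m → Prime p → p ∣ m → p ≤ s p m
carmichael⇒p≤sᵖ {p = 0}    _    pp _ = contradiction pp ¬prime[0]
carmichael⇒p≤sᵖ {p = 1}    _    pp _ = contradiction pp ¬prime[1]
carmichael⇒p≤sᵖ {m} {p = 2+ b} carm pp p∣m@(divides n m≡np) = ≡1-mod⇒< 1<sᵖm sᵖm≡1
  where
  m≡pn : m ≡ 2+ b * n
  m≡pn = trans m≡np (*-comm n (2+ b))
  p∤n : ¬ 2+ b ∣ n
  p∤n p∣n = carmichael⇒squarefree carm (2+ b) pp (subst (2+ b * 2+ b ∣_) (sym m≡pn) (*-monoʳ-∣ (2+ b) p∣n))
  1<sᵖm : 1 < s (2+ b) m
  1<sᵖm = subst (λ k → 1 < s (2+ b) k) (sym m≡pn)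
    (subst (1 <_) (sym (s-*base b n)) (s-≥2 b (quotient>1 p∣m (primeDivisor<composite (proj₁ carm) pp p∣m)) p∤n))
  sᵖm≡1 : s (2+ b) m ≡ 1 mod suc b
  sᵖm≡1 = mod-trans (s-≡mod b m) (∣∸⇒≡mod (<⇒≤ (carmichael>1 carm)) (carmichael⇒korselt carm pp p∣m))

Carmichael⊆S' : Carmichael ⊆ S'
Carmichael⊆S' m carm = primeDecomposition 1<m (squarefreeFactorisation (carmichael⇒squarefree carm))
  λ p pp p∣m → primeDivisor<composite (proj₁ carm) pp p∣m , carmichael⇒p≤sᵖ carm pp p∣m
  where
  1<m : 1 < m
  1<m = carmichael>1 carm
  instance
    m≢0 : NonZero m
    m≢0 = >-nonZero (<-trans z<s 1<m)

C'⇒korselt : ∀ {m p} → C' m → Prime p → p ∣ m → (p ∸ 1) ∣ (m ∸ 1)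
C'⇒korselt {p = 0}    _ pp _ = contradiction pp ¬prime[0]
C'⇒korselt {p = 1}    _ pp _ = contradiction pp ¬prime[1]
C'⇒korselt {m} {p = 2+ b} (1<m , _ , sᵖm≡p) pp p∣m = ≡mod⇒∣∸ (<⇒≤ 1<m) (begin
  m             ≈⟨ s-≡mod b m ⟨
  s (2+ b) m    ≡⟨ sᵖm≡p (2+ b) pp p∣m ⟩
  1 + suc b     ≈⟨ congruent 0 1 refl ⟩
  1             ∎)
  where open ≡-mod-Reasoning (suc b)

C'⇒composite : ∀ {m} → C' m → Composite m
C'⇒composite {m} (1<m , _ , sᵖm≡p) = ¬prime⇒composite {{n>1⇒nonTrivial 1<m}} m-not-prime
  where
  m-not-prime : ¬ Prime m
  m-not-prime m-prime = s[g]g≢g 1<m (sᵖm≡p m m-prime ∣-refl)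

C'⊆S∩Carmichael : C' ⊆ (S ∩ Carmichael)
C'⊆S∩Carmichael m c'@(1<m , sq , sᵖm≡p) =
    strictPrimeDecomposition 1<m (squarefreeFactorisation sq)
      (λ p pp p∣m → primeDivisor<composite m-composite pp p∣m , sᵖm≡p p pp p∣m)
  , korselt⇒carmichael m-composite sq (λ _ → C'⇒korselt c')
  where
  m-composite : Composite m
  m-composite = C'⇒composite c'
  instance
    m≢0 : NonZero m
    m≢0 = >-nonZero (<-trans z<s 1<m)

lookup-injective : ∀ {A : Set} {xs : List A} → Unique xs → ∀ {i j} → lookup xs i ≡ lookup xs j → i ≡ j
lookup-injective (_   ∷ _) {zero}  {zero}  _  = refl
lookup-injective (x∉ ∷ _) {zero}  {suc j} eq = ⊥-elim (All.lookup x∉ (∈-lookup j) eq)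
lookup-injective (x∉ ∷ _) {suc i} {zero}  eq = ⊥-elim (All.lookup x∉ (∈-lookup i) (sym eq))
lookup-injective (_   ∷ u) {suc i} {suc j} eq = cong suc (lookup-injective u eq)

unique-⊆⇒length≤ : ∀ {A : Set} {xs ys : List A} → Unique xs → All (_∈ ys) xs → length xs ≤ length ys
unique-⊆⇒length≤ {xs = xs} {ys} unique xs⊆ys = injective⇒≤ {f = position} position-injective
  where
  position : Fin (length xs) → Fin (length ys)
  position i = index (All.lookup xs⊆ys (∈-lookup i))
  position-injective : ∀ {i j} → position i ≡ position j → i ≡ j
  position-injective {i} {j} eq = lookup-injective unique (begin
    lookup xs i             ≡⟨ lookup-index (All.lookup xs⊆ys (∈-lookup i)) ⟩
    lookup ys (position i)  ≡⟨ cong (lookup ys) eq ⟩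
    lookup ys (position j)  ≡⟨ lookup-index (All.lookup xs⊆ys (∈-lookup j)) ⟨
    lookup xs j             ∎)
    where open ≡-Reasoning

∃-prime-divisor : ∀ {n} → 1 < n → ∃ λ p → Prime p × p ∣ n
∃-prime-divisor {1}        (s≤s ())
∃-prime-divisor {n@(2+ _)} _ with factorise n
... | record { factors = [] ; isFactorisation = () }
... | record { factors = p ∷ ps ; isFactorisation = n≡p*ps ; factorsPrime = pp ∷ _ } =
  p , pp , divides (product ps) (trans n≡p*ps (*-comm p (product ps)))

composite⇒∃-prime-pair : ∀ {n} → Composite n → ∃ λ p → ∃ λ q → Prime p × Prime q × p * q ∣ n
composite⇒∃-prime-pair (composite {d} d<n d∣n@(divides c n≡cd))
  with p , pp , p∣d ← ∃-prime-divisor (nonTrivial⇒n>1 d)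
     | q , qp , q∣c ← ∃-prime-divisor (quotient>1 d∣n d<n) =
  p , q , pp , qp , subst (p * q ∣_) (trans (*-comm d c) (sym n≡cd)) (*-pres-∣ p∣d q∣c)

three-prime-factors⇒¬composite-split : ∀ {m g n} → HasNPrimeFactors 3 m → Squarefree m →
                                       m ≡ g * n → Composite g → Composite n → ⊥
three-prime-factors⇒¬composite-split {m} {g} {n} (ps , length≡3 , _ , _ , complete) sq m≡gn g-composite n-composite
  with p , q , pp , qp , pq∣g ← composite⇒∃-prime-pair g-composite
     | t , t′ , tp , t′p , tt′∣n ← composite⇒∃-prime-pair n-composite =
  <-irrefl refl (subst (4 ≤_) length≡3 (unique-⊆⇒length≤ unique (
    complete p pp (∣-trans p∣g g∣m) ∷ complete q qp (∣-trans q∣g g∣m) ∷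
    complete t tp (∣-trans t∣n n∣m) ∷ complete t′ t′p (∣-trans t′∣n n∣m) ∷ [])))
  where
  p∣g : p ∣ g
  p∣g = m*n∣⇒m∣ p q pq∣g
  q∣g : q ∣ g
  q∣g = m*n∣⇒n∣ p q pq∣g
  t∣n : t ∣ n
  t∣n = m*n∣⇒m∣ t t′ tt′∣n
  t′∣n : t′ ∣ n
  t′∣n = m*n∣⇒n∣ t t′ tt′∣n
  g∣m : g ∣ m
  g∣m = divides n (trans m≡gn (*-comm g n))
  n∣m : n ∣ m
  n∣m = divides g m≡gn
  cross : ∀ {x y} → Prime x → x ∣ g → y ∣ n → x ≢ y
  cross xp x∣g y∣n = squarefree⇒≢ sq xp (subst (_ ∣_) (sym m≡gn) (*-pres-∣ x∣g y∣n))
  unique : Unique (p ∷ q ∷ t ∷ t′ ∷ [])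
  unique = (squarefree⇒≢ sq pp (∣-trans pq∣g g∣m) ∷ cross pp p∣g t∣n ∷ cross pp p∣g t′∣n ∷ [])
         ∷ (cross qp q∣g t∣n ∷ cross qp q∣g t′∣n ∷ [])
         ∷ (squarefree⇒≢ sq tp (∣-trans tt′∣n n∣m) ∷ [])
         ∷ []
         ∷ []

base≤cofactor : ∀ b {n} → s (2+ b) (2+ b * n) ≡ 2+ b → 2+ b ≤ n
base≤cofactor b {n} sᵍ[gn]≡g with n <? 2+ b
... | yes n<g = ⊥-elim (<⇒≢ n<g (trans (sym (s-<base b n<g)) (trans (sym (s-*base b n)) sᵍ[gn]≡g)))
... | no  n≮g = ≮⇒≥ n≮g

korselt-cofactor≤ : ∀ {n g} → 0 < n → 1 < g → (n ∸ 1) ∣ (n * g ∸ 1) → n ≤ g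
korselt-cofactor≤ {suc n′} {suc g′} _ (s≤s 0<g′) n′∣ = s≤s (∣⇒≤ {{>-nonZero 0<g′}}
  (∣m+n∣m⇒∣n (subst (n′ ∣_) (+-comm g′ (n′ * suc g′)) n′∣) (m∣m*n (suc g′))))

strict-base-prime : ∀ {m g} → Cₙ 3 m → 1 < g → g ∣ m → s g m ≡ g → Prime g
strict-base-prime {m} {2+ b} (carm , three) _ (divides n m≡ng) sᵍm≡g =
  decidable-stable (prime? g) λ g-not-prime → g-not-prime (subst Prime (n≡g g-not-prime) (n-prime g-not-prime))
  where
  g = 2+ b
  m≡gn : m ≡ g * n
  m≡gn = trans m≡ng (*-comm n g)
  g≤n : g ≤ n
  g≤n = base≤cofactor b (trans (cong (s g) (sym m≡gn)) sᵍm≡g)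
  n-prime : ¬ Prime g → Prime n
  n-prime g-not-prime = decidable-stable (prime? n) λ n-not-prime →
    three-prime-factors⇒¬composite-split three (carmichael⇒squarefree carm) m≡gn
      (¬prime⇒composite g-not-prime) (¬prime⇒composite {{n>1⇒nonTrivial (<-≤-trans (s≤s (s≤s z≤n)) g≤n)}} n-not-prime)
  n≡g : ¬ Prime g → n ≡ g
  n≡g g-not-prime = ≤-antisym (korselt-cofactor≤ (<-≤-trans z<s g≤n) (s≤s (s≤s z≤n))
    (subst (λ k → (n ∸ 1) ∣ (k ∸ 1)) m≡ng (carmichael⇒korselt carm (n-prime g-not-prime) (divides g m≡gn)))) g≤n

prime∣prime⇒≡ : ∀ {p q} → Prime p → Prime q → p ∣ q → p ≡ q
prime∣prime⇒≡ pp qp p∣q with prime⇒irreducible qp p∣q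
... | inj₁ refl = contradiction pp ¬prime[1]
... | inj₂ p≡q  = p≡q

prime∣^⇒∣ : ∀ {p x} → Prime p → ∀ e → p ∣ x ^ e → p ∣ x
prime∣^⇒∣ pp zero    p∣1 = contradiction (subst Prime (∣1⇒≡1 p∣1) pp) ¬prime[1]
prime∣^⇒∣ {x = x} pp (suc e) p∣x^[1+e] = [ id , prime∣^⇒∣ pp e ]′ (euclidsLemma x (x ^ e) pp p∣x^[1+e])

prime∣product⇒∃ : ∀ {A : Set} {p} (f : A → ℕ) xs → Prime p → p ∣ product (map f xs) → ∃ λ x → x ∈ xs × p ∣ f x
prime∣product⇒∃ f []       pp p∣1 = contradiction (subst Prime (∣1⇒≡1 p∣1) pp) ¬prime[1]
prime∣product⇒∃ f (x ∷ xs) pp p∣fx*fxs with euclidsLemma (f x) (product (map f xs)) pp p∣fx*fxs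
... | inj₁ p∣fx   = x , here refl , p∣fx
... | inj₂ p∣fxs with y , y∈xs , p∣fy ← prime∣product⇒∃ f xs pp p∣fxs = y , there y∈xs , p∣fy

module _ {m} (D : SDecomposition m) where
  open SDecomposition D

  base∣ : ∀ {g e} → (g , e) ∈ factors → g ∣ m
  base∣ {g} {e} ge∈ with _ , _ , 1≤e , _ ← All.lookup valid ge∈ =
    ∣-trans (g∣g^e 1≤e) (subst (g ^ e ∣_) prod (∈⇒∣product (∈-map⁺ _ ge∈)))
    where
    g∣g^e : ∀ {e} → 1 ≤ e → g ∣ g ^ e
    g∣g^e (s≤s _) = m∣m*n _

  prime∣⇒∣base : ∀ {p} → Prime p → p ∣ m → ∃ λ ge → ge ∈ factors × p ∣ proj₁ ge
  prime∣⇒∣base pp p∣m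
    with (g , e) , ge∈ , p∣g^e ← prime∣product⇒∃ _ factors pp (subst (_ ∣_) (sym prod) p∣m) =
    (g , e) , ge∈ , prime∣^⇒∣ pp e p∣g^e

S∩C₃⊆C'₃ : (S ∩ Cₙ 3) ⊆ C'ₙ 3
S∩C₃⊆C'₃ m (strict-decomposition , c₃@(carm , three)) =
  (carmichael>1 carm , carmichael⇒squarefree carm , sᵖm≡p) , three
  where
  open StrictSDecomposition strict-decomposition
  open SDecomposition decomp
  sᵖm≡p : ∀ p → Prime p → p ∣ m → s p m ≡ p
  sᵖm≡p p pp p∣m
    with (g , e) , ge∈ , p∣g ← prime∣⇒∣base decomp pp p∣m
    with 1<g , _ ← All.lookup valid ge∈ =
    subst (λ x → s x m ≡ x) (sym p≡g) sᵍm≡g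
    where
    sᵍm≡g : s g m ≡ g
    sᵍm≡g = All.lookup strict ge∈
    p≡g : p ≡ g
    p≡g = prime∣prime⇒≡ pp (strict-base-prime c₃ 1<g (base∣ decomp ge∈) sᵍm≡g) p∣g

C'₃⊆S∩C₃ : C'ₙ 3 ⊆ (S ∩ Cₙ 3)
C'₃⊆S∩C₃ m (c' , three) with strict , carm ← C'⊆S∩Carmichael m c' = strict , carm , three

≤! : ∀ {m n} {m≤n : True (m ≤? n)} → m ≤ n
≤! {m≤n = m≤n} = toWitness m≤n

∣! : ∀ {m n} {m∣n : True (m ∣? n)} → m ∣ n
∣! {m∣n = m∣n} = toWitness m∣n

∤! : ∀ {m n} {m∤n : False (m ∣? n)} → ¬ m ∣ n
∤! {m∤n = m∤n} = toWitnessFalse m∤n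

prime! : ∀ {n} {n-prime : True (prime? n)} → Prime n
prime! {n-prime = n-prime} = toWitness n-prime

S'[24] : S' 24
S'[24] = record
  { factors    = (2 , 3) ∷ (3 , 1) ∷ []
  ; nonempty   = λ ()
  ; increasing = ≤! ∷ [-]
  ; valid      = (≤! , ≤! , ≤! , ≤!) ∷ (≤! , ≤! , ≤! , ≤!) ∷ []
  ; prod       = refl
  }

¬Carmichael[24] : ¬ Carmichael 24
¬Carmichael[24] carm = carmichael⇒squarefree carm 2 prime! ∣!

S[172081] : S 172081
S[172081] = record
  { decomp = record
    { factors    = (31 , 1) ∷ (61 , 1) ∷ (91 , 1) ∷ []
    ; nonempty   = λ ()
    ; increasing = ≤! ∷ ≤! ∷ [-]
    ; valid      = (≤! , ≤! , ≤! , ≤!) ∷ (≤! , ≤! , ≤! , ≤!) ∷ (≤! , ≤! , ≤! , ≤!) ∷ []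
    ; prod       = refl
    }
  ; strict = refl ∷ refl ∷ refl ∷ []
  }

Carmichael[172081] : Carmichael 172081
Carmichael[172081] = korselt⇒carmichael (composite {d = 7} ≤! ∣!) squarefree korselt
  where
  prime-divisors : ∀ {p} → Prime p → p ∣ 172081 → p ∈ 7 ∷ 13 ∷ 31 ∷ 61 ∷ []
  prime-divisors pp p∣ = factorisationHasAllPrimeFactors pp p∣ (prime! ∷ prime! ∷ prime! ∷ prime! ∷ [])
  squarefree : Squarefree 172081
  squarefree p pp p²∣ with prime-divisors pp (∣-trans (m∣m*n p) p²∣)
  ... | here refl                         = ∤! p²∣
  ... | there (here refl)                 = ∤! p²∣
  ... | there (there (here refl))         = ∤! p²∣
  ... | there (there (there (here refl))) = ∤! p²∣
  korselt : ∀ p → Prime p → p ∣ 172081 → (p ∸ 1) ∣ 172080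
  korselt p pp p∣ with prime-divisors pp p∣
  ... | here refl                         = ∣!
  ... | there (here refl)                 = ∣!
  ... | there (there (here refl))         = ∣!
  ... | there (there (there (here refl))) = ∣!

¬C'[172081] : ¬ C' 172081
¬C'[172081] (_ , _ , sᵖm≡p) = 19≢7 (trans (sym s₇≡19) (sᵖm≡p 7 prime! ∣!))
  where
  19≢7 : 19 ≢ 7
  19≢7 ()
  s₇≡19 : s 7 172081 ≡ 19
  s₇≡19 = refl

theorem2p2 : (Carmichael ⊂ S') × (C' ⊂ (S ∩ Carmichael)) × (C'ₙ 3 ≐ (S ∩ Cₙ 3))
theorem2p2 =
    (Carmichael⊆S' , 24 , S'[24] , ¬Carmichael[24])
  , (C'⊆S∩Carmichael , 172081 , (S[172081] , Carmichael[172081]) , ¬C'[172081])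
  , (C'₃⊆S∩C₃ , S∩C₃⊆C'₃)
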